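{- There is no choice of integers $i,j,u,d,g,w,k,h,v$ satisfying all of the following with $d=1$: $i>0$, $j>0$, $u>0$, $d>0$ odd, $g>1$ odd, $w>0$, $g^w$ is the greatest odd divisor of $(d+2)^k-d^k$, $k>0$ even, $2^h\parallel 2d+2$, $2^v\parallel k$, and $k-v=h-\frac{iw}{j}$. (That is, the parameter $d$ cannot equal $1$ in the infinite family (iv).)
   Context: The infinite family (iv) consists of $(a,b,c)=(2^ig^j,\,2^{iu-1}g^{ju}d,\,2^{iu-1}g^{ju}(d+2))$ with solutions $(x_1,y_1,z_1)=(u,1,1)$ and $(x_2,y_2,z_2)=(ku+\frac wj,k,k)$ of $a^x+b^y=c^z$, where the parameters satisfy the constraints listed in the claim. For a prime $p$, $p^e\parallel m$ means $p^e\mid m$ and $p^{e+1}\nmid m$. -}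

module Defs where

open import Data.Nat using (ℕ; _+_; _*_; _^_; _≤_)
open import Data.Nat.Divisibility using (_∣_)
open import Data.Product using (_×_; ∃)
open import Relation.Nullary using (¬_)
open import Relation.Binary.PropositionalEquality using (_≡_)

Odd : ℕ → Set
Odd n = ∃ λ t → n ≡ 2 * t + 1

Even : ℕ → Set
Even n = ∃ λ t → n ≡ 2 * t

_^_∥_ : ℕ → ℕ → ℕ → Set
p ^ e ∥ m = (p ^ e ∣ m) × ¬ (p ^ (e + 1) ∣ m)

IsGreatestOddDivisor : ℕ → ℕ → Set
IsGreatestOddDivisor n m = Odd n × n ∣ m × (∀ q → Odd q → q ∣ m → q ≤ n)

{-# OPTIONS --safe #-}
-- With d = 1 we have 2d + 2 = 4, so h ≤ 2, and the relation j(k − v) = jh − iw with iw > 0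
-- forces k < v + 2. Since 2^v ≤ k and k is even this leaves only k = 2, v = 1.
-- But then (d + 2)^k − d^k = 8 has greatest odd divisor 1, which is not of the form g^w with g > 1.
module Submission where

open import Defs
open import Data.Nat using (zero; suc; _+_; _*_; _^_; _∸_; _<_; _≤_; z≤n; s≤s; >-nonZero)
open import Data.Nat.Properties
open import Data.Nat.Divisibility using (_∣_; ∣⇒≤; ∣1⇒≡1; ∣m+n∣m⇒∣n; m∣m*n)
open import Data.Nat.Coprimality using (Coprime; coprime-divisor)
open import Data.Nat.Primality using (prime; 2-rough; prime⇒irreducible)
open import Data.Integer using (ℤ; +_) renaming (_*_ to _*ℤ_; _-_ to _-ℤ_; _+_ to _+ℤ_)
import Data.Integer.Properties as ℤ
open import Data.Integer.Tactic.RingSolver using (solve-∀)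
open import Data.Product using (_×_; ∃; _,_)
open import Data.Sum using (inj₁; inj₂)
open import Relation.Nullary using (¬_; contradiction)
open import Relation.Binary.PropositionalEquality
  using (_≡_; refl; sym; trans; cong; cong₂; subst; module ≡-Reasoning)

even⇒2∣ : ∀ {n} → Even n → 2 ∣ n
even⇒2∣ (t , refl) = m∣m*n t

odd⇒2∤ : ∀ {n} → Odd n → ¬ (2 ∣ n)
odd⇒2∤ (t , refl) 2∣2t+1 with ∣1⇒≡1 (∣m+n∣m⇒∣n 2∣2t+1 (m∣m*n t))
... | ()

odd⇒coprime-2 : ∀ {n} → Odd n → Coprime n 2
odd⇒coprime-2 odd (d∣n , d∣2) with prime⇒irreducible (prime 2-rough) d∣2
... | inj₁ d≡1 = d≡1
... | inj₂ refl = contradiction d∣n (odd⇒2∤ odd)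

odd∣2^n⇒≡1 : ∀ {q} n → Odd q → q ∣ 2 ^ n → q ≡ 1
odd∣2^n⇒≡1 zero    _   q∣1 = ∣1⇒≡1 q∣1
odd∣2^n⇒≡1 (suc n) odd q∣2*2ⁿ = odd∣2^n⇒≡1 n odd (coprime-divisor (odd⇒coprime-2 odd) q∣2*2ⁿ)

^-cancelˡ-≤ : ∀ m {n o} → 1 < m → m ^ n ≤ m ^ o → n ≤ o
^-cancelˡ-≤ m 1<m mⁿ≤mᵒ = ≮⇒≥ (λ o<n → <⇒≱ (^-monoʳ-< m 1<m o<n) mⁿ≤mᵒ)

4+n≤2^[2+n] : ∀ n → 4 + n ≤ 2 ^ (2 + n)
4+n≤2^[2+n] zero    = ≤-refl
4+n≤2^[2+n] (suc n) = begin
  1 + (4 + n)                 ≤⟨ +-mono-≤ (m^n>0 2 (2 + n)) (4+n≤2^[2+n] n) ⟩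
  2 ^ (2 + n) + 2 ^ (2 + n)   ≡⟨ cong (_+_ (2 ^ (2 + n))) (+-identityʳ (2 ^ (2 + n))) ⟨
  2 ^ (3 + n)                 ∎
  where open ≤-Reasoning

even∧2^v∥k∧k<2+v⇒k≡2 : ∀ {k} v → 0 < k → Even k → 2 ^ v ∥ k → k < 2 + v → k ≡ 2
even∧2^v∥k∧k<2+v⇒k≡2 zero    _   even (_ , 2∤k) _ = contradiction (even⇒2∣ even) 2∤k
even∧2^v∥k∧k<2+v⇒k≡2 (suc zero) 0<k _ (2∣k , _) (s≤s k≤2) =
  ≤-antisym k≤2 (∣⇒≤ {{>-nonZero 0<k}} 2∣k)
even∧2^v∥k∧k<2+v⇒k≡2 (suc (suc n)) 0<k _ (2ᵛ∣k , _) k<4+n =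
  contradiction (≤-trans (4+n≤2^[2+n] n) (∣⇒≤ {{>-nonZero 0<k}} 2ᵛ∣k)) (<⇒≱ k<4+n)

j[k-v]≡jh-iw⇒jk+iw≡jh+jv : ∀ j k v h i w →
  + j *ℤ (+ k -ℤ + v) ≡ + j *ℤ + h -ℤ + i *ℤ + w → j * k + i * w ≡ j * h + j * v
j[k-v]≡jh-iw⇒jk+iw≡jh+jv j k v h i w eq = ℤ.+-injective (begin
  + (j * k + i * w)                                         ≡⟨ pos-*+* j k i w ⟩
  + j *ℤ + k +ℤ + i *ℤ + w                                  ≡⟨ expand (+ j) (+ k) (+ v) (+ i *ℤ + w) ⟩
  + j *ℤ (+ k -ℤ + v) +ℤ + i *ℤ + w +ℤ + j *ℤ + v           ≡⟨ cong (λ x → x +ℤ + i *ℤ + w +ℤ + j *ℤ + v) eq ⟩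
  + j *ℤ + h -ℤ + i *ℤ + w +ℤ + i *ℤ + w +ℤ + j *ℤ + v      ≡⟨ cancel (+ j *ℤ + h) (+ i *ℤ + w) (+ j *ℤ + v) ⟩
  + j *ℤ + h +ℤ + j *ℤ + v                                  ≡⟨ pos-*+* j h j v ⟨
  + (j * h + j * v)                                         ∎)
  where
  open ≡-Reasoning
  pos-*+* : ∀ a b c d → + (a * b + c * d) ≡ + a *ℤ + b +ℤ + c *ℤ + d
  pos-*+* a b c d = trans (ℤ.pos-+ (a * b) (c * d)) (cong₂ _+ℤ_ (ℤ.pos-* a b) (ℤ.pos-* c d))
  expand : ∀ (a x y b : ℤ) → a *ℤ x +ℤ b ≡ a *ℤ (x -ℤ y) +ℤ b +ℤ a *ℤ y
  expand = solve-∀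
  cancel : ∀ (x b y : ℤ) → x -ℤ b +ℤ b +ℤ y ≡ x +ℤ y
  cancel = solve-∀

j[k-v]≡jh-iw⇒k<h+v : ∀ {j k v h i w} → 0 < i → 0 < w →
  + j *ℤ (+ k -ℤ + v) ≡ + j *ℤ + h -ℤ + i *ℤ + w → k < h + v
j[k-v]≡jh-iw⇒k<h+v {j} {k} {v} {h} {i} {w} 0<i 0<w eq = *-cancelˡ-< j k (h + v) (begin-strict
  j * k           <⟨ m<m+n (j * k) (*-mono-≤ 0<i 0<w) ⟩
  j * k + i * w   ≡⟨ j[k-v]≡jh-iw⇒jk+iw≡jh+jv j k v h i w eq ⟩
  j * h + j * v   ≡⟨ *-distribˡ-+ j h v ⟨
  j * (h + v)     ∎)
  where open ≤-Reasoning

lemma8 : ¬ (∃ λ i → ∃ λ j → ∃ λ u → ∃ λ d → ∃ λ g → ∃ λ w → ∃ λ k → ∃ λ h → ∃ λ v →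
    d ≡ 1 × 0 < i × 0 < j × 0 < u × 0 < d × Odd d × 1 < g × Odd g × 0 < w
    × IsGreatestOddDivisor (g ^ w) ((d + 2) ^ k ∸ d ^ k)
    × 0 < k × Even k
    × 2 ^ h ∥ (2 * d + 2)
    × 2 ^ v ∥ k
    × (+ j) *ℤ ((+ k) -ℤ (+ v)) ≡ (+ j) *ℤ (+ h) -ℤ (+ i) *ℤ (+ w))
lemma8 (i , j , u , d , g , w , k , h , v , refl , 0<i , _ , _ , _ , _ , 1<g , _ , 0<w ,
        (gʷ-odd , gʷ∣3ᵏ∸1ᵏ , _) , 0<k , k-even , (2ʰ∣4 , _) , 2ᵛ∥k , eq) =
  <⇒≢ (^-monoʳ-< g 1<g 0<w) (sym (odd∣2^n⇒≡1 3 gʷ-odd gʷ∣8))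
  where
  h≤2 : h ≤ 2
  h≤2 = ^-cancelˡ-≤ 2 (s≤s (s≤s z≤n)) (∣⇒≤ 2ʰ∣4)
  k<2+v : k < 2 + v
  k<2+v = <-≤-trans (j[k-v]≡jh-iw⇒k<h+v {j} {k} {v} {h} 0<i 0<w eq) (+-monoˡ-≤ v h≤2)
  k≡2 : k ≡ 2
  k≡2 = even∧2^v∥k∧k<2+v⇒k≡2 v 0<k k-even 2ᵛ∥k k<2+v
  gʷ∣8 : g ^ w ∣ 2 ^ 3
  gʷ∣8 = subst (λ n → g ^ w ∣ 3 ^ n ∸ 1 ^ n) k≡2 gʷ∣3ᵏ∸1ᵏ
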